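{- Let $T$ be an alternation acyclic tournament on $\{1,\ldots,n\}$, and let $\pi$ be any linear extension of the right-alternating walk order $\preceq$ induced by $T$ (i.e. a permutation of $\{1,\ldots,n\}$ with $\pi^{ -1}(u)\le \pi^{ -1}(v)$ whenever $u\preceq v$). Then there is a unique function $p:\{1,\ldots,n\}\to\{2,\ldots,n\}\cup\{\infty\}$ satisfying $p(i)>i$ for all $i$ such that $T(\pi,p)=T$.
   Context: A tournament on $\{1,\ldots,n\}$ has, for each pair $i\neq j$, exactly one of the arcs $i\to j$, $j\to i$. An arc $i\to j$ is an ascent if $i<j$ and a descent if $i>j$. A tournament is alternation acyclic if it has no directed cycle along which ascents and descents alternate. The right-alternating walk relation: $u\preceq v$ if $u=v$ or there is a directed walk $u=w_0\to w_1\to\cdots\to w_{2i}=v$ ($i\ge1$) whose arcs $w_{2r}\to w_{2r+1}$ are descents and $w_{2r+1}\to w_{2r+2}$ are ascents; for alternation acyclic $T$ this is a partial order. For a permutation $\pi$ and such a $p$, $T(\pi,p)$ is the tournament in which, for all $u<v$, $u\to v$ if $p(u)\neq\infty$ and $\pi^{ -1}(v)\geq\pi^{ -1}(p(u))$, and $v\to u$ otherwise. -}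

module Defs where

open import Data.Nat as ℕ using (ℕ; zero; suc; NonZero)
open import Data.Nat.DivMod using (_%_; m%n<n)
open import Data.Bool using (Bool; true; false; not; if_then_else_)
open import Data.Fin using (Fin; toℕ; fromℕ<; _<_; _≤_; _≤?_; _<?_)
open import Data.Fin.Permutation using (Permutation′; _⟨$⟩ˡ_)
open import Data.Maybe using (Maybe; just; nothing)
open import Data.Product using (_×_; Σ; ∃)
open import Relation.Nullary using (¬_; ⌊_⌋)
open import Relation.Binary.PropositionalEquality using (_≡_; _≢_)
open import Relation.Binary.Construct.Closure.ReflexiveTransitive using (Star)
open import Function using (_⇔_)
open import Function.Definitions using (Injective)

-- A directed graph on the vertex set {1,…,n}, encoded as Fin n (order preserved):
-- Arcs T u v ≡ true means the arc u → v is present.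
Digraph : ℕ → Set
Digraph n = Fin n → Fin n → Bool

IsTournament : ∀ {n} → Digraph n → Set
IsTournament {n} T =
  (∀ (i : Fin n) → T i i ≡ false) ×
  (∀ (i j : Fin n) → i ≢ j → T i j ≡ not (T j i))

module _ {n : ℕ} (T : Digraph n) where

  at : (m : ℕ) .{{_ : NonZero m}} → (Fin m → Fin n) → ℕ → Fin n
  at m c i = c (fromℕ< (m%n<n i m))

  AltCycle : (m : ℕ) .{{_ : NonZero m}} → (Fin m → Fin n) → Set
  AltCycle m c =
    Injective _≡_ _≡_ c ×
    (∀ (i : ℕ) → T (at m c i) (at m c (suc i)) ≡ true) ×
    (∀ (i : ℕ) → (at m c i < at m c (suc i)) ⇔ (¬ (at m c (suc i) < at m c (suc (suc i)))))

  AlternationAcyclic : Set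
  AlternationAcyclic =
    ∀ (m : ℕ) .{{_ : NonZero m}} (c : Fin m → Fin n) → ¬ AltCycle m c

  data DAStep : Fin n → Fin n → Set where
    da : ∀ {u w v} → w < u → T u w ≡ true → w < v → T w v ≡ true → DAStep u v

  _⪯_ : Fin n → Fin n → Set
  u ⪯ v = Star DAStep u v

-- π : Permutation′ n, where π ⟨$⟩ʳ k is π(k) and π ⟨$⟩ˡ u is π⁻¹(u).
IsLinearExtension : ∀ {n} → Digraph n → Permutation′ n → Set
IsLinearExtension {n} T π =
  ∀ (u v : Fin n) → _⪯_ T u v → (π ⟨$⟩ˡ u) ≤ (π ⟨$⟩ˡ v)

-- p : vertices → vertices ∪ {∞} (nothing = ∞), with p(i) > i.
Increasing : ∀ {n} → (Fin n → Maybe (Fin n)) → Set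
Increasing {n} p = ∀ (i j : Fin n) → p i ≡ just j → i < j

forward : ∀ {n} → Permutation′ n → (Fin n → Maybe (Fin n)) → Fin n → Fin n → Bool
forward π p u v with p u
... | nothing = false
... | just w = ⌊ (π ⟨$⟩ˡ w) ≤? (π ⟨$⟩ˡ v) ⌋

Tπp : ∀ {n} → Permutation′ n → (Fin n → Maybe (Fin n)) → Digraph n
Tπp π p u v =
  if ⌊ u <? v ⌋ then forward π p u v
  else (if ⌊ v <? u ⌋ then not (forward π p v u) else false)

SameTournament : ∀ {n} → Digraph n → Digraph n → Set
SameTournament {n} T T′ = ∀ (u v : Fin n) → T u v ≡ T′ u v

-- Row u of T(π,p) above the diagonal says: u beats exactly those v > u that π
-- does not place before p(u). So p(u) can only be the π-first vertex above u
-- that u beats (∞ if there is none), which gives uniqueness. With this choice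
-- T(π,p) = T: a vertex v > u beating u with π⁻¹(v) ≥ π⁻¹(p(u)) is impossible,
-- because v → u → p(u) is a descent followed by an ascent, so v ⪯ p(u) and
-- hence π⁻¹(v) ≤ π⁻¹(p(u)), forcing v = p(u), which u beats.
module Submission where

open import Defs
open import Data.Nat using (ℕ; zero; suc; z≤n; s≤s)
import Data.Nat.Properties as ℕ
open import Data.Fin using (Fin; zero; suc; _<_; _≤_; _≤?_; _<?_)
open import Data.Fin.Properties using (≤-antisym; ≤∧≢⇒<; <⇒≢; <-cmp)
open import Data.Fin.Permutation using (Permutation′; _⟨$⟩ˡ_; _⟨$⟩ʳ_; inverseˡ; inverseʳ)
open import Data.Maybe using (Maybe; just; nothing)
open import Data.Bool using (true; false; not)
open import Data.Bool.Properties using (¬-not; not-¬)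
open import Data.Product using (Σ; _×_; _,_; proj₁; proj₂; ∃)
open import Data.Sum using (_⊎_; inj₁; inj₂)
open import Function using (_∘_)
open import Level using (Level)
open import Relation.Nullary using (¬_; yes; no; contradiction)
open import Relation.Nullary.Decidable using (Dec; ⌊_⌋; isYes≗does; dec-true; dec-false)
open import Relation.Unary using (Pred; Decidable)
open import Relation.Binary using (tri<; tri≈; tri>)
open import Relation.Binary.PropositionalEquality using (_≡_; _≢_; refl; sym; trans; cong; subst)
open import Relation.Binary.Construct.Closure.ReflexiveTransitive using (ε; _◅_)

isYes-true : ∀ {a} {A : Set a} (a? : Dec A) → A → ⌊ a? ⌋ ≡ true
isYes-true a? a = trans (isYes≗does a?) (dec-true a? a)

isYes-false : ∀ {a} {A : Set a} (a? : Dec A) → ¬ A → ⌊ a? ⌋ ≡ false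
isYes-false a? ¬a = trans (isYes≗does a?) (dec-false a? ¬a)

none-or-least : ∀ {ℓ : Level} {n : ℕ} (P : Pred (Fin n) ℓ) → Decidable P →
  (∀ k → ¬ P k) ⊎ ∃ λ k → P k × (∀ j → P j → k ≤ j)
none-or-least {n = zero} P P? = inj₁ λ ()
none-or-least {n = suc n} P P? with P? zero
... | yes P0 = inj₂ (zero , P0 , λ _ _ → z≤n)
... | no ¬P0 with none-or-least (P ∘ suc) (P? ∘ suc)
...   | inj₁ none = inj₁ λ { zero → ¬P0 ; (suc k) → none k }
...   | inj₂ (k , Pk , least) =
  inj₂ (suc k , Pk , λ { zero P0 → contradiction P0 ¬P0 ; (suc j) Pj → s≤s (least j Pj) })

module _ {n : ℕ} (π : Permutation′ n) where

  ⟨$⟩ˡ-injective : ∀ {v w} → π ⟨$⟩ˡ v ≡ π ⟨$⟩ˡ w → v ≡ w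
  ⟨$⟩ˡ-injective e =
    trans (sym (inverseʳ π)) (trans (cong (π ⟨$⟩ʳ_) e) (inverseʳ π))

  module _ (q : Fin n → Maybe (Fin n)) where

    Tπp-< : ∀ {u v} → u < v → Tπp π q u v ≡ forward π q u v
    Tπp-< {u} {v} u<v with u <? v
    ... | yes _   = refl
    ... | no u≮v = contradiction u<v u≮v

    Tπp-> : ∀ {u v} → v < u → Tπp π q u v ≡ not (forward π q v u)
    Tπp-> {u} {v} v<u with u <? v | v <? u
    ... | no _    | yes _  = refl
    ... | yes u<v | _      = contradiction u<v (ℕ.<⇒≯ v<u)
    ... | no _    | no v≮u = contradiction v<u v≮u

    Tπp-refl : ∀ u → Tπp π q u u ≡ false
    Tπp-refl u with u <? u
    ... | no _    = refl
    ... | yes u<u = contradiction u<u (ℕ.<-irrefl refl)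

  module _ (T : Digraph n) where

    OutAbove : Fin n → Fin n → Set
    OutAbove u v = u < v × T u v ≡ true

    FirstOutAbove : Fin n → Maybe (Fin n) → Set
    FirstOutAbove u nothing  = ∀ v → u < v → T u v ≡ false
    FirstOutAbove u (just w) = OutAbove u w × (∀ v → OutAbove u v → π ⟨$⟩ˡ w ≤ π ⟨$⟩ˡ v)

    firstOutAbove-unique : ∀ {u a b} → FirstOutAbove u a → FirstOutAbove u b → a ≡ b
    firstOutAbove-unique {a = nothing} {nothing}  _ _ = refl
    firstOutAbove-unique {a = nothing} {just w}   none ((u<w , uw) , _) =
      contradiction (none w u<w) (not-¬ uw)
    firstOutAbove-unique {a = just w}  {nothing}  ((u<w , uw) , _) none =
      contradiction (none w u<w) (not-¬ uw)
    firstOutAbove-unique {a = just w}  {just w′} (w-out , w-first) (w′-out , w′-first) =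
      cong just (⟨$⟩ˡ-injective (≤-antisym (w-first _ w′-out) (w′-first _ w-out)))

    -- Search along π, i.e. over positions k with the vertex π(k).
    firstOutAbove-exists : ∀ u → ∃ (FirstOutAbove u)
    firstOutAbove-exists u with none-or-least (OutAbove u ∘ (π ⟨$⟩ʳ_)) out?
      where
      out? : Decidable (OutAbove u ∘ (π ⟨$⟩ʳ_))
      out? k with u <? π ⟨$⟩ʳ k | T u (π ⟨$⟩ʳ k)
      ... | yes u<v | true  = yes (u<v , refl)
      ... | yes _   | false = no λ { (_ , ()) }
      ... | no u≮v  | _     = no (u≮v ∘ proj₁)
    ... | inj₁ none = nothing , λ v u<v →
      ¬-not λ uv → none (π ⟨$⟩ˡ v) (subst (OutAbove u) (sym (inverseʳ π)) (u<v , uv))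
    ... | inj₂ (k , k-out , least) = just (π ⟨$⟩ʳ k) , k-out , λ v v-out →
      subst (_≤ π ⟨$⟩ˡ v) (sym (inverseˡ π))
        (least (π ⟨$⟩ˡ v) (subst (OutAbove u) (sym (inverseʳ π)) v-out))

    RowAgrees : (Fin n → Maybe (Fin n)) → Fin n → Set
    RowAgrees q u = ∀ v → u < v → forward π q u v ≡ T u v

    rowAgrees⇒firstOutAbove : ∀ q u → (∀ w → q u ≡ just w → u < w) →
      RowAgrees q u → FirstOutAbove u (q u)
    rowAgrees⇒firstOutAbove q u q-incr agree with q u
    ... | nothing = λ v u<v → sym (agree v u<v)
    ... | just w  = (u<w , uw) , first
      where
      u<w : u < w
      u<w = q-incr w refl
      uw : T u w ≡ true
      uw = trans (sym (agree w u<w)) (isYes-true (π ⟨$⟩ˡ w ≤? π ⟨$⟩ˡ w) ℕ.≤-refl)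
      first : ∀ v → OutAbove u v → π ⟨$⟩ˡ w ≤ π ⟨$⟩ˡ v
      first v (u<v , uv) with π ⟨$⟩ˡ w ≤? π ⟨$⟩ˡ v | agree v u<v
      ... | yes w≤v | _ = w≤v
      ... | no _    | agreement = contradiction (trans agreement uv) λ ()

    module _ (tournament : IsTournament T) (linear : IsLinearExtension T π) where

      inAbove-precedes-outAbove : ∀ {u v w} → OutAbove u w → u < v → T u v ≡ false →
        π ⟨$⟩ˡ v < π ⟨$⟩ˡ w
      inAbove-precedes-outAbove {u} {v} {w} (u<w , uw) u<v uv = ≤∧≢⇒< v⪯w v≢w
        where
        vu : T v u ≡ true
        vu = trans (proj₂ tournament v u (<⇒≢ u<v ∘ sym)) (cong not uv)
        v⪯w : π ⟨$⟩ˡ v ≤ π ⟨$⟩ˡ w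
        v⪯w = linear v w (da u<v vu u<w uw ◅ ε)
        v≢w : π ⟨$⟩ˡ v ≢ π ⟨$⟩ˡ w
        v≢w e = not-¬ uv (subst (λ x → T u x ≡ true) (sym (⟨$⟩ˡ-injective e)) uw)

      firstOutAbove⇒rowAgrees : ∀ q u → FirstOutAbove u (q u) → RowAgrees q u
      firstOutAbove⇒rowAgrees q u first v u<v with q u
      ... | nothing = sym (first v u<v)
      ... | just w with T u v in uv
      ...   | true  = isYes-true (_ ≤? _) (proj₂ first v (u<v , uv))
      ...   | false = isYes-false (_ ≤? _) (ℕ.<⇒≱ (inAbove-precedes-outAbove (proj₁ first) u<v uv))

    sameTournament⇒rowAgrees : ∀ q → SameTournament (Tπp π q) T → ∀ u → RowAgrees q u
    sameTournament⇒rowAgrees q same u v u<v = trans (sym (Tπp-< q u<v)) (same u v)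

    rowAgrees⇒sameTournament : ∀ q → IsTournament T → (∀ u → RowAgrees q u) →
      SameTournament (Tπp π q) T
    rowAgrees⇒sameTournament q (irreflexive , antisymmetric) agree u v with <-cmp u v
    ... | tri< u<v _ _ = trans (Tπp-< q u<v) (agree u v u<v)
    ... | tri≈ _ refl _ = trans (Tπp-refl q u) (sym (irreflexive u))
    ... | tri> _ _ v<u = trans (Tπp-> q v<u)
      (trans (cong not (agree v u v<u)) (sym (antisymmetric u v (<⇒≢ v<u ∘ sym))))

-- Alternation acyclicity only guarantees that ⪯ is a partial order, so that π
-- exists; the construction itself needs just the linear-extension property.
theorem3p8 : ∀ (n : ℕ) (T : Digraph n) → IsTournament T → AlternationAcyclic T →
    ∀ (π : Permutation′ n) → IsLinearExtension T π →
    Σ (Fin n → Maybe (Fin n)) (λ p →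
      (Increasing p × SameTournament (Tπp π p) T) ×
      (∀ (q : Fin n → Maybe (Fin n)) → Increasing q → SameTournament (Tπp π q) T →
        ∀ (i : Fin n) → q i ≡ p i))
theorem3p8 n T tournament _ π linear = p , (p-increasing , p-same) , p-unique
  where
  p : Fin n → Maybe (Fin n)
  p u = proj₁ (firstOutAbove-exists π T u)

  p-first : ∀ u → FirstOutAbove π T u (p u)
  p-first u = proj₂ (firstOutAbove-exists π T u)

  p-increasing : Increasing p
  p-increasing u w p≡w = proj₁ (proj₁ (subst (FirstOutAbove π T u) p≡w (p-first u)))

  p-same : SameTournament (Tπp π p) T
  p-same = rowAgrees⇒sameTournament π T p tournament
    (λ u → firstOutAbove⇒rowAgrees π T tournament linear p u (p-first u))

  p-unique : ∀ q → Increasing q → SameTournament (Tπp π q) T → ∀ u → q u ≡ p u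
  p-unique q q-increasing q-same u = firstOutAbove-unique π T
    (rowAgrees⇒firstOutAbove π T q u (q-increasing u) (sameTournament⇒rowAgrees π T q q-same u))
    (p-first u)
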